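{- For every positive integer $n$ there is an involution $\pi\mapsto\sigma$ on the symmetric group $\mathfrak{S}_n$ such that $\operatorname{lec}(\pi)=n-1-\operatorname{lec}(\sigma)$ and $(\operatorname{inv}-\operatorname{lec})(\pi)=(\operatorname{inv}-\operatorname{lec})(\sigma)$.
   Context: $\mathfrak{S}_n$ is the set of permutations of $[n]=\{1,\dots,n\}$, written as words $\pi=\pi_1\cdots\pi_n$. For a word $w=w_1\cdots w_m$ with distinct letters, $\operatorname{inv}(w)=|\{(i,j): i<j,\ w_i>w_j\}|$. A word $x_1x_2\cdots x_m$ is a hook if $x_1>x_2$ and either $m=2$, or $m\ge 3$ and $x_2<x_3<\cdots<x_m$. Every permutation $\pi$ has a unique factorization (hook factorization) $\pi=p\,\tau_1\tau_2\cdots\tau_r$ as a concatenation where $p$ is an increasing word (possibly empty) and $\tau_1,\dots,\tau_r$ ($r\ge 0$) are hooks. Define $\operatorname{lec}(\pi)=\sum_{i=1}^r\operatorname{inv}(\tau_i)$, and $\operatorname{inv}(\pi)$ the number of inversions of $\pi$. -}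

module Defs where

open import Data.Nat using (ℕ; zero; suc; _+_; _<?_)
open import Data.Fin using (Fin; toℕ)
open import Data.List using (List; []; _∷_; _++_; [_]; length; reverse; filter; map; allFin)
open import Data.Nat.ListAction using (sum)
open import Data.Product using (_×_; _,_)
open import Data.Fin.Permutation using (Permutation′; _⟨$⟩ʳ_)
open import Relation.Binary.PropositionalEquality using (_≡_; refl)
import Relation.Nullary

inv : List ℕ → ℕ
inv []       = 0
inv (x ∷ xs) = length (filter (λ y → y <? x) xs) + inv xs

-- Hook factorization w = p τ₁ ⋯ τᵣ, computed from the right.
-- The last hook starts at the last descent x₁ > x₂ of the word, followed by
-- the maximal increasing run x₂ < ⋯ < xₘ ending at the end of the word.
-- We work on the reversed word: takeRun a bs returns the maximal strictly
-- decreasing run starting with a (in reversed order) and the remainder.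
takeRun : ℕ → List ℕ → List ℕ × List ℕ
takeRun a [] = a ∷ [] , []
takeRun a (b ∷ bs) with b <? a
... | Relation.Nullary.yes _ = go (takeRun b bs)
  where
  go : List ℕ × List ℕ → List ℕ × List ℕ
  go (r , rest) = a ∷ r , rest
... | Relation.Nullary.no _ = a ∷ [] , b ∷ bs

-- factRev fuel (reverse w) = (p , τ₁ ∷ ⋯ ∷ τᵣ ∷ []), with fuel ≥ length w.
factRev : ℕ → List ℕ → List ℕ × List (List ℕ)
factRev zero    _        = [] , []
factRev (suc k) []       = [] , []
factRev (suc k) (a ∷ as) = step (takeRun a as)
  where
  addHook : List ℕ → List ℕ × List (List ℕ) → List ℕ × List (List ℕ)
  addHook τ (p , hs) = p , hs ++ [ τ ]
  step : List ℕ × List ℕ → List ℕ × List (List ℕ)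
  step (r , [])       = reverse r , []
  step (r , z ∷ rest) = addHook (z ∷ reverse r) (factRev k rest)

hookFactorization : List ℕ → List ℕ × List (List ℕ)
hookFactorization w = factRev (length w) (reverse w)

hooks : List ℕ → List (List ℕ)
hooks w with hookFactorization w
... | (_ , hs) = hs

lecW : List ℕ → ℕ
lecW w = sum (map inv (hooks w))

-- The word π₁ ⋯ πₙ of a permutation of [n] (values shifted to 1..n).
word : ∀ {n} → Permutation′ n → List ℕ
word {n} π = map (λ i → suc (toℕ (π ⟨$⟩ʳ i))) (allFin n)

invP : ∀ {n} → Permutation′ n → ℕ
invP π = inv (word π)

lec : ∀ {n} → Permutation′ n → ℕ
lec π = lecW (word π)

private
  t1 : hookFactorization (1 ∷ 3 ∷ 2 ∷ 4 ∷ []) ≡ (1 ∷ [] , (3 ∷ 2 ∷ 4 ∷ []) ∷ [])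
  t1 = refl
  t2 : hookFactorization (3 ∷ 2 ∷ 1 ∷ []) ≡ (3 ∷ [] , (2 ∷ 1 ∷ []) ∷ [])
  t2 = refl
  t3 : hookFactorization (2 ∷ 1 ∷ 5 ∷ 4 ∷ 3 ∷ 6 ∷ 7 ∷ []) ≡ ([] , (2 ∷ 1 ∷ 5 ∷ []) ∷ (4 ∷ 3 ∷ 6 ∷ 7 ∷ []) ∷ [])
  t3 = refl
  t4 : lecW (3 ∷ 1 ∷ 2 ∷ []) ≡ 2
  t4 = refl
  t5 : hookFactorization (1 ∷ 2 ∷ 3 ∷ []) ≡ (1 ∷ 2 ∷ 3 ∷ [] , [])
  t5 = refl

-- Along its hook factorization p τ₁ ⋯ τᵣ, a word with distinct letters splits into blocks: each
-- factor is an increasing word s with its j-th smallest letter moved to the front, and then has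
-- exactly j inversions (j = 0 for the prefix, 0 < j < |s| for a hook).  Keep every letter set and
-- replace j by |s| − j in each hook and by |s| − 1 − j in the first block (the prefix p, or τ₁ when
-- p is empty).  This is an involution on such decompositions, it turns lec = Σ j into n − 1 − lec,
-- and it fixes inv − lec, which counts only inversions between different blocks and so depends
-- only on their letter sets.  A word with distinct letters has exactly one decomposition (read
-- off its hook factorization), so the involution transfers to words and then to permutations.
module Submission where

open import Defs
open import Data.Nat using (ℕ; zero; suc; _+_; _∸_; _<_; _≤_; _<?_; z≤n; s≤s)
open import Data.Nat.Properties
open import Algebra.Properties.CommutativeSemigroup +-commutativeSemigroup using (interchange)
open import Data.Nat.ListAction using (sum)
open import Data.Nat.ListAction.Properties using (sum-↭)
open import Data.Fin using (Fin; zero; suc; toℕ; cast)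
open import Data.Fin.Properties using (toℕ-injective; cast-is-id)
open import Data.Fin.Permutation using (Permutation′; _≈_; _⟨$⟩ʳ_; _⟨$⟩ˡ_; _∘ₚ_; cast-id; inverseˡ)
open import Data.List using (List; []; _∷_; _++_; [_]; _ʳ++_; length; reverse; filter; map; concat; tabulate; lookup; allFin)
open import Data.List.Properties
  using ( length-++; length-filter; length-tabulate; ++-assoc; ++-identityʳ; ++-ʳ++; reverse-involutive
        ; filter-++; filter-none; filter-accept; filter-reject; map-cong; map-∘; map-tabulate
        ; tabulate-cong; tabulate-lookup; ∷-injectiveˡ; ∷-injectiveʳ )
open import Data.List.Relation.Unary.All as All using (All; []; _∷_)
import Data.List.Relation.Unary.All.Properties as All
open import Data.List.Relation.Unary.AllPairs using (AllPairs; []; _∷_)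
open import Data.List.Relation.Unary.Linked using (Linked; [-]; _∷_)
open import Data.List.Relation.Unary.Linked.Properties using (AllPairs⇒Linked)
open import Data.List.Relation.Unary.Unique.Propositional using (Unique)
import Data.List.Relation.Unary.Unique.Propositional.Properties as Unique
open import Data.List.Relation.Binary.Pointwise using (Pointwise; []; _∷_)
open import Data.List.Relation.Binary.Permutation.Setoid using (onIndices)
import Data.List.Relation.Binary.Permutation.Setoid.Properties as Setoid↭
open import Data.List.Relation.Binary.Permutation.Propositional using (_↭_; ↭-refl; ↭-reflexive; ↭-sym; ↭-trans; ↭⇒↭ₛ; prep; swap)
open import Data.List.Relation.Binary.Permutation.Propositional.Properties using (↭-length; filter-↭; map⁺; ++⁺)
open import Data.Product using (Σ; ∃-syntax; _×_; _,_; proj₁; proj₂; map₂)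
open import Relation.Nullary using (yes; no; ¬_)
open import Relation.Binary.PropositionalEquality hiding ([_])
open import Data.Empty using (⊥-elim)
open import Function using (_∘_; id)
open import Data.Nat.Solver using (module +-*-Solver)
open +-*-Solver using (solve; _:+_; _:=_)

Increasing : List ℕ → Set
Increasing = AllPairs _<_

countBelow : ℕ → List ℕ → ℕ
countBelow x v = length (filter (_<? x) v)

countBelow-++ : ∀ x u v → countBelow x (u ++ v) ≡ countBelow x u + countBelow x v
countBelow-++ x u v = trans (cong length (filter-++ (_<? x) u v)) (length-++ (filter (_<? x) u))

countBelow-↭ : ∀ x {v v′} → v ↭ v′ → countBelow x v ≡ countBelow x v′
countBelow-↭ x p = ↭-length (filter-↭ (_<? x) p)

countBelow-∷-below : ∀ {x y} v → y < x → countBelow x (y ∷ v) ≡ suc (countBelow x v)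
countBelow-∷-below {x} v y<x = cong length (filter-accept (_<? x) y<x)

countBelow-∷-notBelow : ∀ {x y} v → ¬ y < x → countBelow x (y ∷ v) ≡ countBelow x v
countBelow-∷-notBelow {x} v y≮x = cong length (filter-reject (_<? x) y≮x)

countBelow-above : ∀ {x v} → All (x <_) v → countBelow x v ≡ 0
countBelow-above {x} x<v = cong length (filter-none (_<? x) (All.map <-asym x<v))

inv-Increasing : ∀ {s} → Increasing s → inv s ≡ 0
inv-Increasing []           = refl
inv-Increasing (x<s ∷ incr) = cong₂ _+_ (countBelow-above x<s) (inv-Increasing incr)

crossInv : List ℕ → List ℕ → ℕ
crossInv u v = sum (map (λ x → countBelow x v) u)

inv-++ : ∀ u v → inv (u ++ v) ≡ inv u + inv v + crossInv u v
inv-++ []      v = sym (+-identityʳ (inv v))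
inv-++ (x ∷ u) v rewrite countBelow-++ x u v | inv-++ u v =
  solve 5 (λ a b c d e → (a :+ b) :+ ((c :+ d) :+ e) := ((a :+ c) :+ d) :+ (b :+ e)) refl
    (countBelow x u) (countBelow x v) (inv u) (inv v) (crossInv u v)

crossInv-↭ : ∀ {u u′ v v′} → u ↭ u′ → v ↭ v′ → crossInv u v ≡ crossInv u′ v′
crossInv-↭ {u} {u′} {v} {v′} p q = begin
  sum (map (λ x → countBelow x v) u)   ≡⟨ cong sum (map-cong (λ x → countBelow-↭ x q) u) ⟩
  sum (map (λ x → countBelow x v′) u)  ≡⟨ sum-↭ (map⁺ _ p) ⟩
  sum (map (λ x → countBelow x v′) u′) ∎
  where open ≡-Reasoning

interInv : List (List ℕ) → ℕ
interInv []       = 0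
interInv (u ∷ us) = crossInv u (concat us) + interInv us

inv-concat : ∀ us → inv (concat us) ≡ sum (map inv us) + interInv us
inv-concat []       = refl
inv-concat (u ∷ us) rewrite inv-++ u (concat us) | inv-concat us =
  solve 4 (λ a b c d → (a :+ (b :+ c)) :+ d := (a :+ b) :+ (d :+ c)) refl
    (inv u) (sum (map inv us)) (interInv us) (crossInv u (concat us))

concat-↭ : ∀ {us vs : List (List ℕ)} → Pointwise _↭_ us vs → concat us ↭ concat vs
concat-↭ []       = ↭-refl
concat-↭ (p ∷ ps) = ++⁺ p (concat-↭ ps)

interInv-↭ : ∀ {us vs : List (List ℕ)} → Pointwise _↭_ us vs → interInv us ≡ interInv vs
interInv-↭ []       = refl
interInv-↭ (p ∷ ps) = cong₂ _+_ (crossInv-↭ p (concat-↭ ps)) (interInv-↭ ps)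

-- A block (s , j) stands for the word toFront (s , j): the increasing word s with its j-th
-- smallest letter moved to the front.  It has exactly j inversions, and is a hook when j > 0.
Block : Set
Block = List ℕ × ℕ

IsBlock : Block → Set
IsBlock (s , j) = Increasing s × j < length s

-- The j-th letter of s and the remaining letters (junk (0 , []) when s is too short).
extract : List ℕ → ℕ → ℕ × List ℕ
extract []       j       = 0 , []
extract (x ∷ xs) zero    = x , xs
extract (x ∷ xs) (suc j) = map₂ (x ∷_) (extract xs j)

toFront : Block → List ℕ
toFront (s , j) = proj₁ (extract s j) ∷ proj₂ (extract s j)

extract-rest-All : ∀ {P : ℕ → Set} s j → All P s → All P (proj₂ (extract s j))
extract-rest-All []       j       []         = []
extract-rest-All (x ∷ xs) zero    (_ ∷ pxs)  = pxs
extract-rest-All (x ∷ xs) (suc j) (px ∷ pxs) = px ∷ extract-rest-All xs j pxs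

extract-letter-All : ∀ {P : ℕ → Set} s j → j < length s → All P s → P (proj₁ (extract s j))
extract-letter-All (x ∷ xs) zero    _        (px ∷ _)   = px
extract-letter-All (x ∷ xs) (suc j) (s≤s j<) (_ ∷ pxs) = extract-letter-All xs j j< pxs

extract-Increasing : ∀ s j → Increasing s → Increasing (proj₂ (extract s j))
extract-Increasing []       j       []          = []
extract-Increasing (x ∷ xs) zero    (_ ∷ incr)  = incr
extract-Increasing (x ∷ xs) (suc j) (x< ∷ incr) = extract-rest-All xs j x< ∷ extract-Increasing xs j incr

countBelow-extract : ∀ s j → j < length s → Increasing s → countBelow (proj₁ (extract s j)) (proj₂ (extract s j)) ≡ j
countBelow-extract (x ∷ xs) zero    _        (x< ∷ _)    = countBelow-above x<
countBelow-extract (x ∷ xs) (suc j) (s≤s j<) (x< ∷ incr) =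
  trans (countBelow-∷-below _ (extract-letter-All xs j j< x<)) (cong suc (countBelow-extract xs j j< incr))

inv-toFront : ∀ {b} → IsBlock b → inv (toFront b) ≡ proj₂ b
inv-toFront {s , j} (incr , j<) =
  trans (cong₂ _+_ (countBelow-extract s j j< incr) (inv-Increasing (extract-Increasing s j incr)))
        (+-identityʳ j)

toFront-↭ : ∀ s j → j < length s → toFront (s , j) ↭ s
toFront-↭ (x ∷ xs) zero    _        = ↭-refl
toFront-↭ (x ∷ xs) (suc j) (s≤s j<) = ↭-trans (swap _ x ↭-refl) (prep x (toFront-↭ xs j j<))

data Hook : List ℕ → Set where
  hook : ∀ {x y ys} → y < x → Increasing (y ∷ ys) → Hook (x ∷ y ∷ ys)

insert : ℕ → List ℕ → List ℕ
insert z []       = [ z ]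
insert z (y ∷ ys) with y <? z
... | yes _ = y ∷ insert z ys
... | no  _ = z ∷ y ∷ ys

insert-All : ∀ {P : ℕ → Set} z s → P z → All P s → All P (insert z s)
insert-All z []       pz []         = pz ∷ []
insert-All z (y ∷ ys) pz (py ∷ pys) with y <? z
... | yes _ = py ∷ insert-All z ys pz pys
... | no  _ = pz ∷ py ∷ pys

insert-Increasing : ∀ z s → Increasing s → All (z ≢_) s → Increasing (insert z s)
insert-Increasing z []       []          []          = [] ∷ []
insert-Increasing z (y ∷ ys) (y< ∷ incr) (z≢y ∷ z≢) with y <? z
... | yes y<z = insert-All z ys y<z y< ∷ insert-Increasing z ys incr z≢
... | no  y≮z = (z<y ∷ All.map (<-trans z<y) y<) ∷ y< ∷ incr
  where z<y = ≤∧≢⇒< (≮⇒≥ y≮z) z≢y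

length-insert : ∀ z s → length (insert z s) ≡ suc (length s)
length-insert z []       = refl
length-insert z (y ∷ ys) with y <? z
... | yes _ = cong suc (length-insert z ys)
... | no  _ = refl

insert-extract : ∀ s j → j < length s → Increasing s → insert (proj₁ (extract s j)) (proj₂ (extract s j)) ≡ s
insert-extract (x ∷ [])     zero    _        _                  = refl
insert-extract (x ∷ y ∷ ys) zero    _        ((x<y ∷ _) ∷ _) with y <? x
... | yes y<x = ⊥-elim (<-asym x<y y<x)
... | no  _   = refl
insert-extract (x ∷ xs)     (suc j) (s≤s j<) (x< ∷ incr) with x <? proj₁ (extract xs j)
... | yes _   = cong (x ∷_) (insert-extract xs j j< incr)
... | no  x≮e = ⊥-elim (x≮e (extract-letter-All xs j j< x<))

extract-insert : ∀ z s → Increasing s → All (z ≢_) s → extract (insert z s) (countBelow z s) ≡ (z , s)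
extract-insert z []       []          []          = refl
extract-insert z (y ∷ ys) (y< ∷ incr) (z≢y ∷ z≢) with y <? z
... | yes y<z rewrite countBelow-∷-below ys y<z | extract-insert z ys incr z≢ = refl
... | no  y≮z rewrite countBelow-∷-notBelow ys y≮z
                    | countBelow-above (All.map (<-trans (≤∧≢⇒< (≮⇒≥ y≮z) z≢y)) y<) = refl

blockOf : List ℕ → Block
blockOf []       = [] , 0
blockOf (z ∷ ys) = insert z ys , countBelow z ys

blockOf-toFront : ∀ {b} → IsBlock b → blockOf (toFront b) ≡ b
blockOf-toFront {s , j} (incr , j<) = cong₂ _,_ (insert-extract s j j< incr) (countBelow-extract s j j< incr)

toFront-blockOf : ∀ z s → Increasing s → All (z ≢_) s → toFront (blockOf (z ∷ s)) ≡ z ∷ s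
toFront-blockOf z s incr z≢ rewrite extract-insert z s incr z≢ = refl

blockOf-IsBlock : ∀ z s → Increasing s → All (z ≢_) s → IsBlock (blockOf (z ∷ s))
blockOf-IsBlock z s incr z≢ =
  insert-Increasing z s incr z≢ , subst (countBelow z s <_) (sym (length-insert z s)) (s≤s (length-filter (_<? z) s))

splitRun : List ℕ → List ℕ × List ℕ
splitRun []       = [] , []
splitRun (a ∷ as) = takeRun a as

factRevStep : ℕ → List ℕ × List ℕ → List ℕ × List (List ℕ)
factRevStep k (r , [])       = reverse r , []
factRevStep k (r , z ∷ rest) = map₂ (_++ [ z ∷ reverse r ]) (factRev k rest)

factRev-suc : ∀ k w → factRev (suc k) w ≡ factRevStep k (splitRun w)
factRev-suc k []       = refl
factRev-suc k (a ∷ as) with takeRun a as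
... | r , []       = refl
... | r , z ∷ rest = refl

-- An ascending run read backwards continues the descending run that takeRun starts at its first letter.
splitRun-ʳ++ : ∀ {y ys acc r rest} → Linked _<_ (y ∷ ys) → takeRun y acc ≡ (y ∷ r , rest) →
               splitRun (ys ʳ++ y ∷ acc) ≡ (ys ʳ++ y ∷ r , rest)
splitRun-ʳ++ {ys = []}                   [-]          run = run
splitRun-ʳ++ {y} {z ∷ zs} {acc} {r} {rest} (y<z ∷ asc) run = splitRun-ʳ++ asc run′
  where
  run′ : takeRun z (y ∷ acc) ≡ (z ∷ y ∷ r , rest)
  run′ with y <? z
  ... | yes _   rewrite run = refl
  ... | no  y≮z = ⊥-elim (y≮z y<z)

factRev-hook : ∀ k X {τ} → Hook τ → factRev (suc k) (τ ʳ++ X) ≡ map₂ (_++ [ τ ]) (factRev k X)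
factRev-hook k X (hook {x} {y} {ys} y<x incr) = begin
  factRev (suc k) (ys ʳ++ y ∷ x ∷ X)               ≡⟨ factRev-suc k (ys ʳ++ y ∷ x ∷ X) ⟩
  factRevStep k (splitRun (ys ʳ++ y ∷ x ∷ X))          ≡⟨ cong (factRevStep k) (splitRun-ʳ++ (AllPairs⇒Linked incr) start) ⟩
  map₂ (_++ [ x ∷ reverse (reverse (y ∷ ys)) ]) (factRev k X)
    ≡⟨ cong (λ τ → map₂ (_++ [ x ∷ τ ]) (factRev k X)) (reverse-involutive (y ∷ ys)) ⟩
  map₂ (_++ [ x ∷ y ∷ ys ]) (factRev k X)          ∎
  where
  open ≡-Reasoning
  start : takeRun y (x ∷ X) ≡ ([ y ] , x ∷ X)
  start with x <? y
  ... | yes x<y = ⊥-elim (<-asym x<y y<x)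
  ... | no  _   = refl

factRev-hooks : ∀ {τs} → All Hook τs → ∀ k X →
                factRev (length τs + k) (concat τs ʳ++ X) ≡ map₂ (_++ τs) (factRev k X)
factRev-hooks {[]}     []       k X = cong (proj₁ (factRev k X) ,_) (sym (++-identityʳ _))
factRev-hooks {τ ∷ τs} (h ∷ hs) k X = begin
  factRev (suc (length τs + k)) ((τ ++ concat τs) ʳ++ X)  ≡⟨ cong₂ factRev (sym (+-suc (length τs) k)) (++-ʳ++ τ) ⟩
  factRev (length τs + suc k) (concat τs ʳ++ τ ʳ++ X)     ≡⟨ factRev-hooks hs (suc k) (τ ʳ++ X) ⟩
  map₂ (_++ τs) (factRev (suc k) (τ ʳ++ X))               ≡⟨ cong (map₂ (_++ τs)) (factRev-hook k X h) ⟩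
  map₂ (_++ τs) (map₂ (_++ [ τ ]) (factRev k X))          ≡⟨ cong (proj₁ (factRev k X) ,_) (++-assoc _ [ τ ] τs) ⟩
  map₂ (_++ τ ∷ τs) (factRev k X)                         ∎
  where open ≡-Reasoning

factRev-Increasing : ∀ k {p} → Increasing p → length p ≤ k → factRev k (p ʳ++ []) ≡ (p , [])
factRev-Increasing zero    {[]}     _    _       = refl
factRev-Increasing (suc k) {[]}     _    _       = refl
factRev-Increasing (suc k) {y ∷ ys} incr _ = begin
  factRev (suc k) (ys ʳ++ [ y ])                     ≡⟨ factRev-suc k (ys ʳ++ [ y ]) ⟩
  factRevStep k (splitRun (ys ʳ++ [ y ]))                ≡⟨ cong (factRevStep k) (splitRun-ʳ++ (AllPairs⇒Linked incr) refl) ⟩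
  (reverse (reverse (y ∷ ys)) , [])                  ≡⟨ cong (_, []) (reverse-involutive (y ∷ ys)) ⟩
  (y ∷ ys , [])                                      ∎
  where open ≡-Reasoning

length≤length-concat : ∀ {τs} → All Hook τs → length τs ≤ length (concat τs)
length≤length-concat []                                   = z≤n
length≤length-concat {(x ∷ y ∷ ys) ∷ τs} (hook _ _ ∷ hs) = s≤s (begin
  length τs                                  ≤⟨ length≤length-concat hs ⟩
  length (concat τs)                         ≤⟨ m≤n+m _ (length (y ∷ ys)) ⟩
  length (y ∷ ys) + length (concat τs)       ≡⟨ length-++ (y ∷ ys) ⟨
  length ((y ∷ ys) ++ concat τs)             ∎)
  where open ≤-Reasoning

hookFactorization-unique : ∀ {p τs} → Increasing p → All Hook τs → hookFactorization (p ++ concat τs) ≡ (p , τs)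
hookFactorization-unique {p} {τs} incr hs = begin
  factRev n ((p ++ concat τs) ʳ++ [])                ≡⟨ cong₂ factRev (sym (m+[n∸m]≡n τs≤n)) (++-ʳ++ p) ⟩
  factRev (length τs + k) (concat τs ʳ++ p ʳ++ [])   ≡⟨ factRev-hooks hs k _ ⟩
  map₂ (_++ τs) (factRev k (p ʳ++ []))               ≡⟨ cong (map₂ (_++ τs)) (factRev-Increasing k incr p≤k) ⟩
  (p , τs)                                           ∎
  where
  open ≡-Reasoning
  n = length (p ++ concat τs)
  k = n ∸ length τs
  bound : length p + length τs ≤ n
  bound = ≤-trans (+-monoʳ-≤ (length p) (length≤length-concat hs)) (≤-reflexive (sym (length-++ p)))
  τs≤n : length τs ≤ n
  τs≤n = m+n≤o⇒n≤o (length p) bound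
  p≤k : length p ≤ k
  p≤k = m+n≤o⇒m≤o∸n (length p) bound

IsHookBlock : Block → Set
IsHookBlock b = IsBlock b × 0 < proj₂ b

toFront-Hook : ∀ {b} → IsHookBlock b → Hook (toFront b)
toFront-Hook {x ∷ xs , suc j} ((x< ∷ incr , s≤s j<) , _) =
  hook (extract-letter-All xs j j< x<) (extract-rest-All xs j x< ∷ extract-Increasing xs j incr)

-- A decomposition encodes the hook factorization: the first block is the increasing prefix
-- when its index is 0 and the first hook otherwise; every later block is a hook.
data Decomposition : List Block → Set where
  decomposition : ∀ {b L} → IsBlock b → All IsHookBlock L → Decomposition (b ∷ L)

Decomposition⇒All-IsBlock : ∀ {L} → Decomposition L → All IsBlock L
Decomposition⇒All-IsBlock (decomposition b hs) = b ∷ All.map proj₁ hs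

spell : List Block → List ℕ
spell L = concat (map toFront L)

indexSum : List Block → ℕ
indexSum L = sum (map proj₂ L)

factorsOf : List Block → List ℕ × List (List ℕ)
factorsOf []                  = [] , []
factorsOf ((s , zero)  ∷ L)   = s , map toFront L
factorsOf ((s , suc j) ∷ L)   = [] , map toFront ((s , suc j) ∷ L)

hookFactorization-spell : ∀ {L} → Decomposition L → hookFactorization (spell L) ≡ factorsOf L
hookFactorization-spell {(x ∷ xs , zero) ∷ L} (decomposition (incr , _) hs) =
  hookFactorization-unique incr (All.map⁺ (All.map toFront-Hook hs))
hookFactorization-spell {(s , suc j) ∷ L} (decomposition b hs) =
  hookFactorization-unique [] (All.map⁺ (All.map toFront-Hook ((b , s≤s z≤n) ∷ hs)))

sum-inv-toFront : ∀ {L} → All IsBlock L → sum (map inv (map toFront L)) ≡ indexSum L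
sum-inv-toFront []       = refl
sum-inv-toFront (b ∷ bs) = cong₂ _+_ (inv-toFront b) (sum-inv-toFront bs)

sum-inv-factorsOf : ∀ {L} → Decomposition L → sum (map inv (proj₂ (factorsOf L))) ≡ indexSum L
sum-inv-factorsOf {(s , zero)  ∷ L} (decomposition _ hs) = sum-inv-toFront (All.map proj₁ hs)
sum-inv-factorsOf {(s , suc j) ∷ L} d                    = sum-inv-toFront (Decomposition⇒All-IsBlock d)

lec-spell : ∀ {L} → Decomposition L → lecW (spell L) ≡ indexSum L
lec-spell d = trans (cong (sum ∘ map inv ∘ proj₂) (hookFactorization-spell d)) (sum-inv-factorsOf d)

toFront-↭-letters : ∀ {L} → All IsBlock L → Pointwise _↭_ (map toFront L) (map proj₁ L)
toFront-↭-letters []                         = []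
toFront-↭-letters {(s , j) ∷ _} ((_ , j<) ∷ bs) = toFront-↭ s j j< ∷ toFront-↭-letters bs

inv-spell : ∀ {L} → All IsBlock L → inv (spell L) ≡ indexSum L + interInv (map proj₁ L)
inv-spell {L} bs = begin
  inv (concat (map toFront L))                              ≡⟨ inv-concat (map toFront L) ⟩
  sum (map inv (map toFront L)) + interInv (map toFront L)  ≡⟨ cong₂ _+_ (sum-inv-toFront bs) (interInv-↭ (toFront-↭-letters bs)) ⟩
  indexSum L + interInv (map proj₁ L)                       ∎
  where open ≡-Reasoning

inv∸lec-spell : ∀ {L} → Decomposition L → inv (spell L) ∸ lecW (spell L) ≡ interInv (map proj₁ L)
inv∸lec-spell {L} d rewrite inv-spell (Decomposition⇒All-IsBlock d) | lec-spell d =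
  m+n∸m≡n (indexSum L) (interInv (map proj₁ L))

blocksOf : List ℕ × List (List ℕ) → List Block
blocksOf ([]    , τs) = map blockOf τs
blocksOf (x ∷ p , τs) = (x ∷ p , 0) ∷ map blockOf τs

map-blockOf-toFront : ∀ {L} → All IsBlock L → map blockOf (map toFront L) ≡ L
map-blockOf-toFront []       = refl
map-blockOf-toFront (b ∷ bs) = cong₂ _∷_ (blockOf-toFront b) (map-blockOf-toFront bs)

blocksOf-factorsOf : ∀ {L} → Decomposition L → blocksOf (factorsOf L) ≡ L
blocksOf-factorsOf {([] , zero) ∷ L}     (decomposition (_ , ()) _)
blocksOf-factorsOf {(x ∷ xs , zero) ∷ L} (decomposition _ hs) = cong (_ ∷_) (map-blockOf-toFront (All.map proj₁ hs))
blocksOf-factorsOf {(s , suc j) ∷ L}     d                    = map-blockOf-toFront (Decomposition⇒All-IsBlock d)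

reflectFirst : Block → Block
reflectFirst (s , j) = s , (length s ∸ 1) ∸ j

reflectHook : Block → Block
reflectHook (s , j) = s , length s ∸ j

reflect : List Block → List Block
reflect []      = []
reflect (b ∷ L) = reflectFirst b ∷ map reflectHook L

reflectHook-IsHookBlock : ∀ {b} → IsHookBlock b → IsHookBlock (reflectHook b)
reflectHook-IsHookBlock {s , j} ((incr , j<) , 0<j) = (incr , ∸-monoʳ-< 0<j (<⇒≤ j<)) , m<n⇒0<n∸m j<

reflect-Decomposition : ∀ {L} → Decomposition L → Decomposition (reflect L)
reflect-Decomposition {(x ∷ xs , j) ∷ L} (decomposition (incr , _) hs) =
  decomposition (incr , s≤s (m∸n≤m (length xs) j)) (All.map⁺ (All.map reflectHook-IsHookBlock hs))

map-reflectHook-involutive : ∀ {L} → All IsHookBlock L → map reflectHook (map reflectHook L) ≡ L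
map-reflectHook-involutive []                          = refl
map-reflectHook-involutive {(s , j) ∷ L} (((_ , j<) , _) ∷ hs) =
  cong₂ _∷_ (cong (s ,_) (m∸[m∸n]≡n (<⇒≤ j<))) (map-reflectHook-involutive hs)

reflect-involutive : ∀ {L} → Decomposition L → reflect (reflect L) ≡ L
reflect-involutive {(x ∷ xs , j) ∷ L} (decomposition (_ , s≤s j≤) hs) =
  cong₂ _∷_ (cong (x ∷ xs ,_) (m∸[m∸n]≡n j≤)) (map-reflectHook-involutive hs)

letters-reflect : ∀ L → map proj₁ (reflect L) ≡ map proj₁ L
letters-reflect []      = refl
letters-reflect (b ∷ L) = cong (proj₁ b ∷_) (trans (sym (map-∘ L)) (map-cong (λ _ → refl) L))

length-spell : ∀ {L} → All IsBlock L → length (spell L) ≡ length (concat (map proj₁ L))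
length-spell bs = ↭-length (concat-↭ (toFront-↭-letters bs))

indexSum-reflectHook : ∀ {L} → All IsHookBlock L →
                       indexSum L + indexSum (map reflectHook L) ≡ length (concat (map proj₁ L))
indexSum-reflectHook []                          = refl
indexSum-reflectHook {(s , j) ∷ L} (((_ , j<) , _) ∷ hs) = begin
  (j + indexSum L) + ((length s ∸ j) + indexSum (map reflectHook L))
    ≡⟨ interchange j (indexSum L) (length s ∸ j) _ ⟩
  (j + (length s ∸ j)) + (indexSum L + indexSum (map reflectHook L))
    ≡⟨ cong₂ _+_ (m+[n∸m]≡n (<⇒≤ j<)) (indexSum-reflectHook hs) ⟩
  length s + length (concat (map proj₁ L))
    ≡⟨ length-++ s ⟨
  length (s ++ concat (map proj₁ L))          ∎
  where open ≡-Reasoning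

indexSum-reflect : ∀ {L} → Decomposition L → indexSum L + indexSum (reflect L) ≡ length (spell L) ∸ 1
indexSum-reflect {(x ∷ xs , j) ∷ L} d@(decomposition (_ , s≤s j≤) hs) = begin
  (j + indexSum L) + ((length xs ∸ j) + indexSum (map reflectHook L))
    ≡⟨ interchange j (indexSum L) (length xs ∸ j) _ ⟩
  (j + (length xs ∸ j)) + (indexSum L + indexSum (map reflectHook L))
    ≡⟨ cong₂ _+_ (m+[n∸m]≡n j≤) (indexSum-reflectHook hs) ⟩
  length xs + length (concat (map proj₁ L))
    ≡⟨ length-++ xs ⟨
  length (concat (map proj₁ ((x ∷ xs , j) ∷ L))) ∸ 1
    ≡⟨ cong (_∸ 1) (length-spell (Decomposition⇒All-IsBlock d)) ⟨
  length (spell ((x ∷ xs , j) ∷ L)) ∸ 1          ∎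
  where open ≡-Reasoning

reflectWord : List ℕ → List ℕ
reflectWord w = spell (reflect (blocksOf (hookFactorization w)))

reflectWord-spell : ∀ {L} → Decomposition L → reflectWord (spell L) ≡ spell (reflect L)
reflectWord-spell d = cong (spell ∘ reflect) (trans (cong blocksOf (hookFactorization-spell d)) (blocksOf-factorsOf d))

reflectWord-↭ : ∀ {L} → Decomposition L → reflectWord (spell L) ↭ spell L
reflectWord-↭ {L} d rewrite reflectWord-spell d = ↭-trans
  (subst (λ ls → spell (reflect L) ↭ concat ls) (letters-reflect L)
    (concat-↭ (toFront-↭-letters (Decomposition⇒All-IsBlock (reflect-Decomposition d)))))
  (↭-sym (concat-↭ (toFront-↭-letters (Decomposition⇒All-IsBlock d))))

reflectWord-involutive : ∀ {L} → Decomposition L → reflectWord (reflectWord (spell L)) ≡ spell L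
reflectWord-involutive {L} d = begin
  reflectWord (reflectWord (spell L))  ≡⟨ cong reflectWord (reflectWord-spell d) ⟩
  reflectWord (spell (reflect L))      ≡⟨ reflectWord-spell (reflect-Decomposition d) ⟩
  spell (reflect (reflect L))          ≡⟨ cong spell (reflect-involutive d) ⟩
  spell L                              ∎
  where open ≡-Reasoning

lec-reflectWord : ∀ {L} → Decomposition L → lecW (spell L) ≡ (length (spell L) ∸ 1) ∸ lecW (reflectWord (spell L))
lec-reflectWord {L} d rewrite reflectWord-spell d | lec-spell d | lec-spell (reflect-Decomposition d) =
  trans (sym (m+n∸n≡m (indexSum L) (indexSum (reflect L)))) (cong (_∸ indexSum (reflect L)) (indexSum-reflect d))

inv∸lec-reflectWord : ∀ {L} → Decomposition L →
                      inv (spell L) ∸ lecW (spell L) ≡ inv (reflectWord (spell L)) ∸ lecW (reflectWord (spell L))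
inv∸lec-reflectWord {L} d rewrite reflectWord-spell d
                                | inv∸lec-spell d | inv∸lec-spell (reflect-Decomposition d) | letters-reflect L = refl

prepend : ℕ → List Block → List Block
prepend c []                = ([ c ] , 0) ∷ []
prepend c ((s , zero)  ∷ L) = blockOf (c ∷ s) ∷ L
prepend c ((s , suc j) ∷ L) = ([ c ] , 0) ∷ (s , suc j) ∷ L

prepend-Decomposition : ∀ {c L} → Decomposition L → All (c ≢_) (spell L) → Decomposition (prepend c L)
prepend-Decomposition {c} {(x ∷ xs , zero) ∷ L} (decomposition (incr , _) hs) c∉ =
  decomposition (blockOf-IsBlock c (x ∷ xs) incr (All.++⁻ˡ (x ∷ xs) c∉)) hs
prepend-Decomposition {c} {(s , suc j) ∷ L} (decomposition b hs) _ =
  decomposition ([] ∷ [] , s≤s z≤n) ((b , s≤s z≤n) ∷ hs)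

spell-prepend : ∀ {c L} → Decomposition L → All (c ≢_) (spell L) → spell (prepend c L) ≡ c ∷ spell L
spell-prepend {c} {([] , zero) ∷ L}     (decomposition (_ , ()) _) _
spell-prepend {c} {(x ∷ xs , zero) ∷ L} (decomposition (incr , _) _) c∉ =
  cong (_++ spell L) (toFront-blockOf c (x ∷ xs) incr (All.++⁻ˡ (x ∷ xs) c∉))
spell-prepend {c} {(s , suc j) ∷ L} _ _ = refl

spell-surjective : ∀ c w → Unique (c ∷ w) → ∃[ L ] Decomposition L × spell L ≡ c ∷ w
spell-surjective c []      _          = [ ([ c ] , 0) ] , decomposition ([] ∷ [] , s≤s z≤n) [] , refl
spell-surjective c (d ∷ w) (c∉ ∷ uniq) with spell-surjective d w uniq
... | L , dec , eq = prepend c L , prepend-Decomposition dec c∉′ , trans (spell-prepend dec c∉′) (cong (c ∷_) eq)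
  where c∉′ = subst (All (c ≢_)) (sym eq) c∉

lookup-tabulate′ : ∀ {A : Set} {n} (f : Fin n → A) i → lookup (tabulate f) i ≡ f (cast (length-tabulate f) i)
lookup-tabulate′ {n = suc n} f zero    = refl
lookup-tabulate′ {n = suc n} f (suc i) = lookup-tabulate′ (f ∘ suc) i

tabulate-lookup-cast : ∀ {A : Set} {n} {xs : List A} (e : n ≡ length xs) {g : Fin n → A} →
                       (∀ i → g i ≡ lookup xs (cast e i)) → tabulate g ≡ xs
tabulate-lookup-cast {xs = xs} refl g≗ =
  trans (tabulate-cong (λ i → trans (g≗ i) (cong (lookup xs) (cast-is-id refl i)))) (tabulate-lookup xs)

tabulate-injective : ∀ {A : Set} {n} {f g : Fin n → A} → tabulate f ≡ tabulate g → ∀ i → f i ≡ g i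
tabulate-injective {n = suc n} eq zero    = ∷-injectiveˡ eq
tabulate-injective {n = suc n} eq (suc i) = tabulate-injective (∷-injectiveʳ eq) i

tabulate-↭ : ∀ {A : Set} {n} (f : Fin n → A) {xs} → xs ↭ tabulate f →
             ∃[ τ ] tabulate (f ∘ (τ ⟨$⟩ʳ_)) ≡ xs
tabulate-↭ {n = n} f {xs} p = τ , tabulate-lookup-cast e at
  where
  open Setoid↭ (setoid _) using (onIndices-lookup)
  p′ = ↭⇒↭ₛ p
  ρ = onIndices p′
  e : n ≡ length xs
  e = sym (trans (↭-length p) (length-tabulate f))
  τ : Permutation′ n
  τ = cast-id e ∘ₚ (ρ ∘ₚ cast-id (length-tabulate f))
  at : ∀ i → f (τ ⟨$⟩ʳ i) ≡ lookup xs (cast e i)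
  at i = sym (trans (onIndices-lookup p′ (cast e i)) (lookup-tabulate′ f (ρ ⟨$⟩ʳ cast e i)))

letter : ∀ {n} → Permutation′ n → Fin n → ℕ
letter π i = suc (toℕ (π ⟨$⟩ʳ i))

word-tabulate : ∀ {n} (π : Permutation′ n) → word π ≡ tabulate (letter π)
word-tabulate π = map-tabulate id (letter π)

length-word : ∀ {n} (π : Permutation′ n) → length (word π) ≡ n
length-word π = trans (cong length (word-tabulate π)) (length-tabulate (letter π))

word-cong : ∀ {n} {π ρ : Permutation′ n} → π ≈ ρ → word π ≡ word ρ
word-cong π≈ρ = map-cong (λ i → cong (suc ∘ toℕ) (π≈ρ i)) (allFin _)

word-injective : ∀ {n} {π ρ : Permutation′ n} → word π ≡ word ρ → π ≈ ρ
word-injective {π = π} {ρ} eq i = toℕ-injective (suc-injective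
  (tabulate-injective (trans (sym (word-tabulate π)) (trans eq (word-tabulate ρ))) i))

word-Unique : ∀ {n} (π : Permutation′ n) → Unique (word π)
word-Unique {n} π = Unique.map⁺ letter-injective (Unique.allFin⁺ n)
  where
  letter-injective : ∀ {i j} → letter π i ≡ letter π j → i ≡ j
  letter-injective {i} {j} eq = begin
    i                        ≡⟨ inverseˡ π ⟨
    π ⟨$⟩ˡ (π ⟨$⟩ʳ i)        ≡⟨ cong (π ⟨$⟩ˡ_) (toℕ-injective (suc-injective eq)) ⟩
    π ⟨$⟩ˡ (π ⟨$⟩ʳ j)        ≡⟨ inverseˡ π ⟩
    j                        ∎
    where open ≡-Reasoning

word-↭ : ∀ {n} (π : Permutation′ n) {xs} → xs ↭ word π → ∃[ σ ] word σ ≡ xs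
word-↭ π p with tabulate-↭ (letter π) (↭-trans p (↭-reflexive (word-tabulate π)))
... | τ , eq = τ ∘ₚ π , trans (word-tabulate (τ ∘ₚ π)) eq

Decomposition-elim : ∀ (P : List ℕ → Set) → (∀ {L} → Decomposition L → P (spell L)) →
                     ∀ {c w} → Unique (c ∷ w) → P (c ∷ w)
Decomposition-elim P onSpell {c} {w} uniq with spell-surjective c w uniq
... | L , d , eq = subst P eq (onSpell d)

reflectPerm-spec : ∀ {m} (π : Permutation′ (suc m)) → ∃[ σ ] word σ ≡ reflectWord (word π)
reflectPerm-spec π = word-↭ π (Decomposition-elim (λ w → reflectWord w ↭ w) reflectWord-↭ (word-Unique π))

reflectPerm : ∀ {m} → Permutation′ (suc m) → Permutation′ (suc m)
reflectPerm π = proj₁ (reflectPerm-spec π)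

word-reflectPerm : ∀ {m} (π : Permutation′ (suc m)) → word (reflectPerm π) ≡ reflectWord (word π)
word-reflectPerm π = proj₂ (reflectPerm-spec π)

reflectPerm-cong : ∀ {m} (π ρ : Permutation′ (suc m)) → π ≈ ρ → reflectPerm π ≈ reflectPerm ρ
reflectPerm-cong π ρ π≈ρ = word-injective {π = reflectPerm π} {reflectPerm ρ} (begin
  word (reflectPerm π)  ≡⟨ word-reflectPerm π ⟩
  reflectWord (word π)  ≡⟨ cong reflectWord (word-cong {π = π} {ρ} π≈ρ) ⟩
  reflectWord (word ρ)  ≡⟨ word-reflectPerm ρ ⟨
  word (reflectPerm ρ)  ∎)
  where open ≡-Reasoning

reflectPerm-involutive : ∀ {m} (π : Permutation′ (suc m)) → reflectPerm (reflectPerm π) ≈ π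
reflectPerm-involutive π = word-injective {π = reflectPerm (reflectPerm π)} {π} (begin
  word (reflectPerm (reflectPerm π))    ≡⟨ word-reflectPerm (reflectPerm π) ⟩
  reflectWord (word (reflectPerm π))    ≡⟨ cong reflectWord (word-reflectPerm π) ⟩
  reflectWord (reflectWord (word π))    ≡⟨ Decomposition-elim (λ w → reflectWord (reflectWord w) ≡ w)
                                                              reflectWord-involutive (word-Unique π) ⟩
  word π                                ∎)
  where open ≡-Reasoning

lec-reflectPerm : ∀ {m} (π : Permutation′ (suc m)) → lec π ≡ m ∸ lec (reflectPerm π)
lec-reflectPerm π = trans
  (Decomposition-elim (λ w → lecW w ≡ (length w ∸ 1) ∸ lecW (reflectWord w)) lec-reflectWord (word-Unique π))
  (cong₂ (λ ℓ w → (ℓ ∸ 1) ∸ lecW w) (length-word π) (sym (word-reflectPerm π)))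

inv∸lec-reflectPerm : ∀ {m} (π : Permutation′ (suc m)) → invP π ∸ lec π ≡ invP (reflectPerm π) ∸ lec (reflectPerm π)
inv∸lec-reflectPerm π = trans
  (Decomposition-elim (λ w → inv w ∸ lecW w ≡ inv (reflectWord w) ∸ lecW (reflectWord w))
                      inv∸lec-reflectWord (word-Unique π))
  (cong (λ w → inv w ∸ lecW w) (sym (word-reflectPerm π)))

lemma2 : (m : ℕ) → let n = suc m in
    Σ (Permutation′ n → Permutation′ n) λ f →
      (∀ π ρ → π ≈ ρ → f π ≈ f ρ)
      × (∀ π → f (f π) ≈ π)
      × (∀ π → lec π ≡ (n ∸ 1) ∸ lec (f π))
      × (∀ π → invP π ∸ lec π ≡ invP (f π) ∸ lec (f π))
lemma2 m = reflectPerm , reflectPerm-cong , reflectPerm-involutive , lec-reflectPerm , inv∸lec-reflectPerm
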